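{- Let $N$ and $M$ be well-formed labeled portnets and let $(M,\phi)$ be a partial mirror of $N$. Let $S=\textit{compose}(\{N,M\})$ with initial marking $i_S=i_N+i_M$ and final marking $f_S=f_N+f_M$. For all markings $m,m',m_0,\dots,m_n\in\mathcal{R}(S,i_S)$ and all transitions $t,t_1,\dots,t_n$ of $N$ such that $m=m_0\xrightarrow{t_1}\cdots\xrightarrow{t_n}m_n$ with $\lambda(t_j)=\textit{receive}$ for all $j$, and $m\xrightarrow{t}m'$ with $\lambda(t)=\textit{send}$, there exist markings $m_0',\dots,m_n'\in\mathcal{R}(S,i_S)$ and transitions $\bar t,t_1',\dots,t_n'$ of $N$ such that $m'=m_0'\xrightarrow{t_1'}\cdots\xrightarrow{t_n'}m_n'$, $m_n\xrightarrow{\bar t}m_n'$, and (1) $\mu(t_j)=\mu(t_j')$ and $\lambda(t_j)=\lambda(t_j')$ for all $j$; (2) $\mu(t)=\mu(\bar t)$ and $\lambda(t)=\lambda(\bar t)$.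
   Context: Petri nets. Labeled Petri net $(P,T,F,\mathcal{L},\mu)$; ${}^\bullet x=\{y\mid (y,x)\in F\}$, $x^\bullet=\{y\mid (x,y)\in F\}$; markings $m:P\to\mathbb{N}$; $t$ enabled at $m$ iff ${}^\bullet t\le m$, firing gives $m-{}^\bullet t+t^\bullet$, written $m\xrightarrow{t}m'$; $\mathcal{R}(N,m)$ is the set of markings reachable from $m$. A path is a sequence of nodes with consecutive pairs in $F$. OPNs. $N=(P,I,O,T,F,\textit{init},\textit{fin},\mathcal{L},\mu)$, $P,I,O$ pairwise disjoint, $(P\cup I\cup O,T,F,\mathcal{L},\mu)$ labeled Petri net, ${}^\bullet x=\emptyset$ for $x\in I$, $x^\bullet=\emptyset$ for $x\in O$, each $t$ has ${}^\bullet t\cap I=\emptyset$ or $t^\bullet\cap O=\emptyset$, $\textit{init},\textit{fin}\subseteq P$. $\lambda(t)=\textit{send}$ if $t^\bullet\cap O\ne\emptyset$, $\textit{receive}$ if ${}^\bullet t\cap I\ne\emptyset$, else $\tau$. Skeleton: net on $P,T$ with arcs $F\cap((P\times T)\cup(T\times P))$. Labeled portnet: OPN whose skeleton has each transition with at most one input and one output place and is a workflow net (unique place $i$ with empty preset, unique $f$ with empty postset, all nodes on a path from $i$ to $f$), $\textit{init}=\{i\}$, $\textit{fin}=\{f\}$ (written $i_N,f_N$); each transition connected to exactly one interface place; transitions sharing an interface place share a label; equally labeled transitions are connected to the same interface place(s). Composition: $N,M$ composable iff shared nodes are exactly $(I_N\cup O_N)\cap(I_M\cup O_M)$ and, if $(I_N\cap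 O_M)\cup(I_M\cap O_N)\ne\emptyset$, then $O_N\subseteq I_M$, $O_M\subseteq I_N$, $I_N\cap I_M=O_N\cap O_M=\emptyset$. $\textit{compose}$: places $\bigcup P\cup(\bigcup I\cap\bigcup O)$, inputs $\bigcup I\setminus\bigcup O$, outputs $\bigcup O\setminus\bigcup I$, other components unions. Partial mirror of $N$: $(M,\phi)$, $M$ a labeled portnet, $\phi$ injective from nodes of $M$ to nodes of $N$ with $\phi(P_M)\subseteq P_N$, $\phi(T_M)\subseteq T_N$, $\phi(I_M)\subseteq O_N$, $\phi(O_M)\subseteq I_N$; for $(x,y)\in F_M$: if $x\notin I_M,y\notin O_M$ then $(\phi(x),\phi(y))\in F_N$, if $x\in I_M$ or $y\in O_M$ then $(\phi(y),\phi(x))\in F_N$; $\phi(\textit{init}_M)=\textit{init}_N$, $\phi(\textit{fin}_M)=\textit{fin}_N$; $\mu_M(t)=\mu_N(\phi(t))$; for all $p\in P_M$, $t\in\phi(p)^\bullet$ with $\lambda(t)=\textit{send}$ there is $t'\in p^\bullet$ with $\phi(t')=t$. In $\textit{compose}(\{N,M\})$ each interface place $x$ of $M$ is the same place as $\phi(x)$, and $N,M$ share no other nodes. Well-formed labeled portnet: observable choices (distinct $t,t'\in p^\bullet$ have distinct labels); diamond property (for $p\in P$, $t,t'\in p^\bullet$ with $\lambda(t)\ne\lambda(t')$, for all $q\in t^\bullet\cap P$, $q'\in t'^\bullet\cap P$ there are $u\in q^\bullet$, $u'\in q'^\bullet$ with $u^\bullet\cap u'^\bullet\ne\emptyset$,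 $\mu(t)=\mu(u')$, $\mu(t')=\mu(u)$); loop property (for $p\in P$ and distinct $t,t'\in p^\bullet$ with $\lambda(t)=\lambda(t')$, every path $\langle p\rangle\circ\pi$ whose transitions are $\langle t\rangle\circ\sigma\circ\langle t''\rangle$ with $\mu(t'')=\mu(t')$ and no transition of $\sigma$ labeled $\mu(t')$ contains a transition of direction $\ne\lambda(t)$). -}

module Defs where

open import Data.Nat using (ℕ; _+_; _≤_)
open import Data.Nat.Properties using (_≟_)
open import Data.Fin using (Fin; zero; suc; inject₁; fromℕ)
open import Data.Bool using (Bool; true; false; if_then_else_)
open import Data.Product using (Σ; ∃; ∃-syntax; _×_; _,_)
open import Data.Product.Properties using (≡-dec)
open import Data.Sum using (_⊎_)
open import Data.List using (List; []; _∷_; _++_; filter)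
open import Data.List.Membership.Propositional using (_∈_; _∉_)
import Data.List.Membership.DecPropositional as DecMem
open import Data.List.Relation.Unary.All using (All)
open import Data.List.Relation.Unary.Any using (Any; any?)
open import Data.List.Relation.Unary.Linked using (Linked)
open import Relation.Binary.Construct.Closure.ReflexiveTransitive using (Star)
open import Relation.Binary.PropositionalEquality using (_≡_; _≢_; _≗_)
open import Relation.Nullary using (¬_; does)

-- All nodes (places, interface places, transitions) are names in ℕ; this
-- makes composition (gluing along equally-named interface places) literal.
-- Finite sets of nodes are lists (read up to membership), the flow relation
-- is a finite list of pairs, labels are natural numbers (the alphabet L is
-- left implicit).  Markings are functions ℕ → ℕ (value irrelevant/zero off
-- the places of the net).

module NatMem = DecMem _≟_
module PairMem = DecMem (≡-dec _≟_ _≟_)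

Node : Set
Node = ℕ

Marking : Set
Marking = Node → ℕ

record OPN : Set where
  field
    P I O T : List Node
    F       : List (Node × Node)
    init fin : List Node
    μ       : Node → ℕ          -- labeling (meaningful on T)
open OPN public

Arc : OPN → Node → Node → Set
Arc N x y = (x , y) ∈ F N

Conn : OPN → Node → Node → Set
Conn N x y = Arc N x y ⊎ Arc N y x

Places : OPN → List Node
Places N = P N ++ I N ++ O N

Ifc : OPN → List Node
Ifc N = I N ++ O N

Nodes : OPN → List Node
Nodes N = P N ++ I N ++ O N ++ T N

Disj : List Node → List Node → Set
Disj A B = ∀ x → x ∈ A → x ∉ B

_⊆_ : List Node → List Node → Set
A ⊆ B = ∀ x → x ∈ A → x ∈ B

record IsOPN (N : OPN) : Set where
  field
    disjPI  : Disj (P N) (I N)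
    disjPO  : Disj (P N) (O N)
    disjIO  : Disj (I N) (O N)
    disjPlT : Disj (Places N) (T N)
    flowOK  : ∀ x y → Arc N x y →
              (x ∈ Places N × y ∈ T N) ⊎ (x ∈ T N × y ∈ Places N)
    inNoPre   : ∀ x y → x ∈ I N → ¬ Arc N y x
    outNoPost : ∀ x y → x ∈ O N → ¬ Arc N x y
    dirOK   : ∀ t → t ∈ T N →
              (∀ x → x ∈ I N → ¬ Arc N x t) ⊎ (∀ x → x ∈ O N → ¬ Arc N t x)
    initOK  : init N ⊆ P N
    finOK   : fin N ⊆ P N

data Dir : Set where
  send receive τ : Dir

arc? : (N : OPN) → Node → Node → Bool
arc? N x y = does (PairMem._∈?_ (x , y) (F N))

dir : OPN → Node → Dir
dir N t =
  if does (any? (λ o → PairMem._∈?_ (t , o) (F N)) (O N)) then send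
  else if does (any? (λ i → PairMem._∈?_ (i , t) (F N)) (I N)) then receive
  else τ

SkArc : OPN → Node → Node → Set
SkArc N x y = Arc N x y × ((x ∈ P N × y ∈ T N) ⊎ (x ∈ T N × y ∈ P N))

record IsLPortnet (N : OPN) : Set where
  field
    isOPN : IsOPN N
    oneIn  : ∀ t p q → t ∈ T N → p ∈ P N → q ∈ P N →
             Arc N p t → Arc N q t → p ≡ q
    oneOut : ∀ t p q → t ∈ T N → p ∈ P N → q ∈ P N →
             Arc N t p → Arc N t q → p ≡ q
    -- skeleton is a workflow net
    i f : Node
    i∈P : i ∈ P N
    f∈P : f ∈ P N
    iNoPre  : ∀ x → ¬ SkArc N x i
    iUnique : ∀ p → p ∈ P N → (∀ x → ¬ SkArc N x p) → p ≡ i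
    fNoPost : ∀ x → ¬ SkArc N f x
    fUnique : ∀ p → p ∈ P N → (∀ x → ¬ SkArc N p x) → p ≡ f
    onPath  : ∀ x → x ∈ P N ++ T N → Star (SkArc N) i x × Star (SkArc N) x f
    init≡ : (∀ x → x ∈ init N → x ≡ i) × i ∈ init N
    fin≡  : (∀ x → x ∈ fin N → x ≡ f) × f ∈ fin N
    oneIfc : ∀ t → t ∈ T N →
             ∃[ x ] (x ∈ Ifc N × Conn N x t × (∀ y → y ∈ Ifc N → Conn N y t → y ≡ x))
    sharedLabel : ∀ t t' x → t ∈ T N → t' ∈ T N → x ∈ Ifc N →
                  Conn N x t → Conn N x t' → μ N t ≡ μ N t'
    sameIfc : ∀ t t' x → t ∈ T N → t' ∈ T N → μ N t ≡ μ N t' → x ∈ Ifc N →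
              (Conn N x t → Conn N x t') × (Conn N x t' → Conn N x t)

transOf : OPN → List Node → List Node
transOf N = filter (λ x → NatMem._∈?_ x (T N))

ObservableChoices : OPN → Set
ObservableChoices N = ∀ p t t' → p ∈ P N → Arc N p t → Arc N p t' →
  t ≢ t' → μ N t ≢ μ N t'

DiamondProperty : OPN → Set
DiamondProperty N = ∀ p t t' → p ∈ P N → Arc N p t → Arc N p t' →
  dir N t ≢ dir N t' →
  ∀ q q' → Arc N t q → q ∈ P N → Arc N t' q' → q' ∈ P N →
  ∃[ u ] ∃[ u' ] (Arc N q u × Arc N q' u' ×
                  (∃[ r ] (Arc N u r × Arc N u' r)) ×
                  μ N t ≡ μ N u' × μ N t' ≡ μ N u)

LoopProperty : OPN → Set
LoopProperty N = ∀ p t t' → p ∈ P N → Arc N p t → Arc N p t' → t ≢ t' →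
  dir N t ≡ dir N t' →
  ∀ (π σ : List Node) (t'' : Node) →
  Linked (Arc N) (p ∷ π) →
  transOf N (p ∷ π) ≡ t ∷ (σ ++ t'' ∷ []) →
  μ N t'' ≡ μ N t' →
  All (λ u → μ N u ≢ μ N t') σ →
  Any (λ u → dir N u ≢ dir N t) (transOf N (p ∷ π))

record WellFormed (N : OPN) : Set where
  field
    portnet : IsLPortnet N
    obs     : ObservableChoices N
    diamond : DiamondProperty N
    loop    : LoopProperty N

Composable : OPN → OPN → Set
Composable N M =
  (∀ x → x ∈ Nodes N → x ∈ Nodes M → x ∈ Ifc N × x ∈ Ifc M) ×
  ((∃[ x ] ((x ∈ I N × x ∈ O M) ⊎ (x ∈ I M × x ∈ O N))) →
     (O N ⊆ I M) × (O M ⊆ I N) ×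
     (∀ x → x ∈ I N → x ∉ I M) × (∀ x → x ∈ O N → x ∉ O M))

compose : OPN → OPN → OPN
compose N M = record
  { P    = P N ++ P M ++ filter (λ x → NatMem._∈?_ x (O N ++ O M)) (I N ++ I M)
  ; I    = filter (λ x → Relation.Nullary.¬? (NatMem._∈?_ x (O N ++ O M))) (I N ++ I M)
  ; O    = filter (λ x → Relation.Nullary.¬? (NatMem._∈?_ x (I N ++ I M))) (O N ++ O M)
  ; T    = T N ++ T M
  ; F    = F N ++ F M
  ; init = init N ++ init M
  ; fin  = fin N ++ fin M
  ; μ    = λ x → if does (NatMem._∈?_ x (T N)) then μ N x else μ M x
  }
  where import Relation.Nullary

-- partial mirror (M , φ) of N, with the convention that in compose N M
-- each interface place x of M is the same node as φ x
record PartialMirror (N M : OPN) (φ : Node → Node) : Set where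
  field
    portnetM : IsLPortnet M
    inj      : ∀ x y → x ∈ Nodes M → y ∈ Nodes M → φ x ≡ φ y → x ≡ y
    mapP     : ∀ x → x ∈ P M → φ x ∈ P N
    mapT     : ∀ x → x ∈ T M → φ x ∈ T N
    mapI     : ∀ x → x ∈ I M → φ x ∈ O N
    mapO     : ∀ x → x ∈ O M → φ x ∈ I N
    arcFwd   : ∀ x y → Arc M x y → x ∉ I M → y ∉ O M → Arc N (φ x) (φ y)
    arcBwd   : ∀ x y → Arc M x y → (x ∈ I M ⊎ y ∈ O M) → Arc N (φ y) (φ x)
    initMap  : (∀ x → x ∈ init M → φ x ∈ init N) ×
               (∀ y → y ∈ init N → ∃[ x ] (x ∈ init M × φ x ≡ y))
    finMap   : (∀ x → x ∈ fin M → φ x ∈ fin N) ×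
               (∀ y → y ∈ fin N → ∃[ x ] (x ∈ fin M × φ x ≡ y))
    labels   : ∀ t → t ∈ T M → μ M t ≡ μ N (φ t)
    sends    : ∀ p t → p ∈ P M → Arc N (φ p) t → dir N t ≡ send →
               ∃[ t' ] (Arc M p t' × φ t' ≡ t)
    ifcSame  : ∀ x → x ∈ Ifc M → φ x ≡ x

ind : Bool → ℕ
ind true  = 1
ind false = 0

mark : List Node → Marking
mark A p = ind (does (NatMem._∈?_ p A))

pre post : OPN → Node → Marking
pre  N t p = ind (arc? N p t)
post N t p = ind (arc? N t p)

Fire : OPN → Marking → Node → Marking → Set
Fire N m t m' = t ∈ T N × (∀ p → pre N t p ≤ m p) ×
                (∀ p → m' p + pre N t p ≡ m p + post N t p)

Step : OPN → Marking → Marking → Set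
Step N m m' = ∃[ t ] Fire N m t m'

Reach : OPN → Marking → Marking → Set
Reach N m₀ m = Star (Step N) m₀ m

initS : OPN → OPN → Marking
initS N M p = mark (init N) p + mark (init M) p

-- A reachable marking of the composition carries exactly one token on the places of N: the
-- skeleton of N is a state machine started with one token on i, and M never touches a place of N.
-- Hence the send t and the receive t₁ enabled at m₀ share their input place p, and the diamond
-- property at p yields a receive u with the label of t₁ after t and a send u′ with the label of t
-- after t₁; the pre- and post-sets of these four transitions show that firing t u and t₁ u′ from
-- m₀ ends in the same marking.  Repeating this square along t₁ … tₙ builds the run from m′, with
-- copies of t as the rungs mⱼ → m′ⱼ.

module Submission where

open import Defs
open import Data.Nat using (ℕ; zero; suc; _+_; _∸_; _≤_)
open import Data.Nat.Properties
  using (_≟_; +-comm; +-identityʳ; +-cancelʳ-≡; +-cancelʳ-≤; +-monoˡ-≤; +-monoʳ-≤; m≤m+n; m∸n+n≡m; ≤-trans; ≤-reflexive; module ≤-Reasoning)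
open import Data.Nat.Tactic.RingSolver using (solve; solve-∀)
open import Data.Fin using (Fin; zero; suc; inject₁; fromℕ)
open import Data.Product using (Σ; ∃-syntax; _×_; _,_; proj₁; proj₂)
open import Data.Sum using (_⊎_; inj₁; inj₂; [_,_]; map; map₂)
open import Data.Empty using (⊥-elim)
open import Data.List using (List; _∷_; [])
open import Data.List.Membership.Propositional using (_∈_; _∉_; find; lose)
open import Data.List.Membership.Propositional.Properties using (∈-++⁺ˡ; ∈-++⁺ʳ; ∈-++⁻)
open import Data.List.Relation.Binary.Subset.Propositional.Properties using (xs⊆xs++ys; ++⁺ʳ)
open import Data.List.Relation.Unary.Any using (Any; any?)
open import Data.Bool using (if_then_else_)
open import Function.Bundles using (_⇔_; mk⇔)
open import Relation.Binary.Construct.Closure.ReflexiveTransitive using (Star; ε; _◅_; _◅◅_; reverse)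
open import Relation.Binary.PropositionalEquality
  using (_≡_; _≢_; _≗_; refl; sym; trans; cong; cong₂; cong-app; subst; subst₂; module ≡-Reasoning)
open import Relation.Nullary using (¬_; Dec; yes; no; does)
open import Relation.Nullary.Decidable using (does-⇔; dec-true; dec-false; _⊎-dec_)

δ : Node → Marking
δ a q = ind (does (q ≟ a))

_⊕_ : Marking → Marking → Marking
(m ⊕ m′) q = m q + m′ q

ind-⇔ : {A B : Set} → A ⇔ B → (A? : Dec A) (B? : Dec B) → ind (does A?) ≡ ind (does B?)
ind-⇔ A⇔B A? B? = cong ind (does-⇔ A⇔B A? B?)

ind-present : {A : Set} (A? : Dec A) → A → ind (does A?) ≡ 1
ind-present A? a = cong ind (dec-true A? a)

ind-absent : {A : Set} (A? : Dec A) → ¬ A → ind (does A?) ≡ 0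
ind-absent A? ¬a = cong ind (dec-false A? ¬a)

ind-positive : {A : Set} (A? : Dec A) → 1 ≤ ind (does A?) → A
ind-positive (yes a) _ = a
ind-positive (no _) ()

ind-⊎ : {A B : Set} (A? : Dec A) (B? : Dec B) → ¬ (A × B) →
        ind (does (A? ⊎-dec B?)) ≡ ind (does A?) + ind (does B?)
ind-⊎ (yes a) (yes b) ¬both = ⊥-elim (¬both (a , b))
ind-⊎ (yes _) (no _)  _     = refl
ind-⊎ (no _)  (yes _) _     = refl
ind-⊎ (no _)  (no _)  _     = refl

indicator-δ : {A : Node → Set} (A? : ∀ q → Dec (A q)) {a : Node} →
              (∀ q → A q ⇔ q ≡ a) → ∀ q → ind (does (A? q)) ≡ δ a q
indicator-δ A? {a} A⇔ q = ind-⇔ (A⇔ q) (A? q) (q ≟ a)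

indicator-δ⊕δ : {A : Node → Set} (A? : ∀ q → Dec (A q)) {a b : Node} → a ≢ b →
                (∀ q → A q ⇔ (q ≡ a ⊎ q ≡ b)) → ∀ q → ind (does (A? q)) ≡ (δ a ⊕ δ b) q
indicator-δ⊕δ A? {a} {b} a≢b A⇔ q =
  trans (ind-⇔ (A⇔ q) (A? q) ((q ≟ a) ⊎-dec (q ≟ b)))
        (ind-⊎ (q ≟ a) (q ≟ b) λ (q≡a , q≡b) → a≢b (trans (sym q≡a) q≡b))

-- Token balance at one place, cₓ and pₓ being what x consumes and produces there.  Adding the
-- balances of s, t, u′ and the effect identity, everything but m₂ + cu and m₀ + pu cancels.
square-balance : ∀ {m m₀ m₁ m₂ cs ps ct pt cu pu cu′ pu′ : ℕ} →
  m₀ + cs ≡ m + ps → m₁ + ct ≡ m + pt → m₂ + cu′ ≡ m₁ + pu′ →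
  cs + cu + pt + pu′ ≡ ct + cu′ + ps + pu → m₂ + cu ≡ m₀ + pu
square-balance {m} {m₀} {m₁} {m₂} {cs} {ps} {ct} {pt} {cu} {pu} {cu′} {pu′} s t u′ effect =
  +-cancelʳ-≡ (m + m₁ + cs + ps + ct + pt + cu′ + pu′) (m₂ + cu) (m₀ + pu) (begin
    m₂ + cu + (m + m₁ + cs + ps + ct + pt + cu′ + pu′)
      ≡⟨ solve vars ⟩
    (m₂ + cu′) + (m₁ + ct) + (cs + cu + pt + pu′) + (m + ps)
      ≡⟨ cong₂ _+_ (cong₂ _+_ (cong₂ _+_ u′ t) effect) (sym s) ⟩
    (m₁ + pu′) + (m + pt) + (ct + cu′ + ps + pu) + (m₀ + cs)
      ≡⟨ solve vars ⟩
    m₀ + pu + (m + m₁ + cs + ps + ct + pt + cu′ + pu′) ∎)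
  where
  open ≡-Reasoning
  vars : List ℕ
  vars = m ∷ m₀ ∷ m₁ ∷ m₂ ∷ cs ∷ ps ∷ ct ∷ pt ∷ cu ∷ pu ∷ cu′ ∷ pu′ ∷ []

module Firing (X : OPN) where

  fire : ∀ {m t} → t ∈ T X → (∀ q → pre X t q ≤ m q) → Fire X m t (λ q → m q + post X t q ∸ pre X t q)
  fire {m} {t} t∈ enabled = t∈ , enabled , λ q → m∸n+n≡m (≤-trans (enabled q) (m≤m+n (m q) (post X t q)))

  enabled-after : ∀ {m m₀ s t u} → Fire X m s m₀ → (∀ q → pre X t q ≤ m q) →
                  (∀ q → pre X u q + pre X s q ≤ pre X t q + post X s q) → ∀ q → pre X u q ≤ m₀ q
  enabled-after {m} {m₀} {s} {t} {u} (_ , _ , balance) t-enabled bound q =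
    +-cancelʳ-≤ (pre X s q) (pre X u q) (m₀ q) (begin
      pre X u q + pre X s q   ≤⟨ bound q ⟩
      pre X t q + post X s q  ≤⟨ +-monoˡ-≤ (post X s q) (t-enabled q) ⟩
      m q + post X s q        ≡⟨ balance q ⟨
      m₀ q + pre X s q        ∎)
    where open ≤-Reasoning

  fire-square : ∀ {m m₀ m₁ m₂ s t u u′} → Fire X m s m₀ → Fire X m t m₁ → Fire X m₁ u′ m₂ →
    u ∈ T X → (∀ q → pre X u q ≤ m₀ q) →
    (∀ q → pre X s q + pre X u q + post X t q + post X u′ q ≡ pre X t q + pre X u′ q + post X s q + post X u q) →
    Fire X m₀ u m₂
  fire-square {m} {m₀} {m₁} {m₂} (_ , _ , s-balance) (_ , _ , t-balance) (_ , _ , u′-balance) u∈ u-enabled same-effect =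
    u∈ , u-enabled , λ q →
      square-balance {m q} {m₀ q} {m₁ q} {m₂ q} (s-balance q) (t-balance q) (u′-balance q) (same-effect q)

open Firing

places-cases : ∀ X {x} → x ∈ Places X → x ∈ P X ⊎ x ∈ I X ⊎ x ∈ O X
places-cases X x∈ = map₂ (∈-++⁻ (I X)) (∈-++⁻ (P X) x∈)

places⊆nodes : ∀ X {x} → x ∈ Places X → x ∈ Nodes X
places⊆nodes X = ++⁺ʳ (P X) (++⁺ʳ (I X) (xs⊆xs++ys (O X) (T X)))

transitions⊆nodes : ∀ X {x} → x ∈ T X → x ∈ Nodes X
transitions⊆nodes X x∈ = ∈-++⁺ʳ (P X) (∈-++⁺ʳ (I X) (∈-++⁺ʳ (O X) x∈))

arc-nodes : ∀ {X x y} → IsOPN X → Arc X x y → x ∈ Nodes X × y ∈ Nodes X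
arc-nodes {X} {x} {y} opn x→y with IsOPN.flowOK opn x y x→y
... | inj₁ (x∈ , y∈) = places⊆nodes X x∈ , transitions⊆nodes X y∈
... | inj₂ (x∈ , y∈) = transitions⊆nodes X x∈ , places⊆nodes X y∈

SameAction : OPN → Node → Node → Set
SameAction N x y = μ N x ≡ μ N y × dir N x ≡ dir N y

same-action-trans : ∀ {N x y z} → SameAction N x y → SameAction N y z → SameAction N x z
same-action-trans (μx≡μy , dx≡dy) (μy≡μz , dy≡dz) = trans μx≡μy μy≡μz , trans dx≡dy dy≡dz

send≢receive : send ≢ receive
send≢receive ()

module LabeledPortnet {N : OPN} (portnet : IsLPortnet N) where
  open IsLPortnet portnet using (isOPN; oneIn; oneOut; i∈P; f∈P; onPath; oneIfc; sameIfc)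
  open IsOPN isOPN using (disjPI; disjPO; disjPlT; flowOK; inNoPre; outNoPost; dirOK)

  Sends Receives : Node → Set
  Sends u = Any (λ o → Arc N u o) (O N)
  Receives u = Any (λ x → Arc N x u) (I N)

  sends? : ∀ u → Dec (Sends u)
  sends? u = any? (λ o → PairMem._∈?_ (u , o) (F N)) (O N)

  receives? : ∀ u → Dec (Receives u)
  receives? u = any? (λ x → PairMem._∈?_ (x , u) (F N)) (I N)

  data DirView (u : Node) : Dir → Set where
    sending   : Sends u → DirView u send
    receiving : ¬ Sends u → Receives u → DirView u receive
    internal  : ¬ Sends u → ¬ Receives u → DirView u τ

  dir-view : ∀ u → DirView u (dir N u)
  dir-view u with sends? u
  ... | yes s = sending s
  ... | no ¬s with receives? u
  ...   | yes r = receiving ¬s r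
  ...   | no ¬r = internal ¬s ¬r

  sends-of-send : ∀ {u} → dir N u ≡ send → Sends u
  sends-of-send {u} d with subst (DirView u) d (dir-view u)
  ... | sending s = s

  receive-view : ∀ {u} → dir N u ≡ receive → ¬ Sends u × Receives u
  receive-view {u} d with subst (DirView u) d (dir-view u)
  ... | receiving ¬s r = ¬s , r

  send-no-input : ∀ {u x} → u ∈ T N → dir N u ≡ send → x ∈ I N → ¬ Arc N x u
  send-no-input {u} u∈ d x∈ x→u with dirOK u u∈ | find (sends-of-send d)
  ... | inj₁ no-input  | _             = no-input _ x∈ x→u
  ... | inj₂ no-output | o , o∈ , u→o = no-output o o∈ u→o

  output-transfer : ∀ {u v o} → u ∈ T N → v ∈ T N → μ N u ≡ μ N v → o ∈ O N → Arc N u o → Arc N v o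
  output-transfer {u} {v} {o} u∈ v∈ e o∈ u→o
    with proj₁ (sameIfc u v o u∈ v∈ e (∈-++⁺ʳ (I N) o∈)) (inj₂ u→o)
  ... | inj₁ o→v = ⊥-elim (outNoPost o v o∈ o→v)
  ... | inj₂ v→o = v→o

  input-transfer : ∀ {u v x} → u ∈ T N → v ∈ T N → μ N u ≡ μ N v → x ∈ I N → Arc N x u → Arc N x v
  input-transfer {u} {v} {x} u∈ v∈ e x∈ x→u
    with proj₁ (sameIfc u v x u∈ v∈ e (∈-++⁺ˡ x∈)) (inj₁ x→u)
  ... | inj₁ x→v = x→v
  ... | inj₂ v→x = ⊥-elim (inNoPre x v x∈ v→x)

  dir-μ : ∀ {u v} → u ∈ T N → v ∈ T N → μ N u ≡ μ N v → dir N u ≡ dir N v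
  dir-μ {u} {v} u∈ v∈ e =
    cong₂ (λ sends receives → if sends then send else if receives then receive else τ)
      (does-⇔ (mk⇔ (sends-transfer u∈ v∈ e) (sends-transfer v∈ u∈ (sym e))) (sends? u) (sends? v))
      (does-⇔ (mk⇔ (receives-transfer u∈ v∈ e) (receives-transfer v∈ u∈ (sym e))) (receives? u) (receives? v))
    where
    sends-transfer : ∀ {u v} → u ∈ T N → v ∈ T N → μ N u ≡ μ N v → Sends u → Sends v
    sends-transfer u∈ v∈ e s with find s
    ... | o , o∈ , u→o = lose o∈ (output-transfer u∈ v∈ e o∈ u→o)
    receives-transfer : ∀ {u v} → u ∈ T N → v ∈ T N → μ N u ≡ μ N v → Receives u → Receives v
    receives-transfer u∈ v∈ e r with find r
    ... | x , x∈ , x→u = lose x∈ (input-transfer u∈ v∈ e x∈ x→u)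

  P-arc-target : ∀ {q u} → q ∈ P N → Arc N q u → u ∈ T N
  P-arc-target {q} {u} q∈ q→u with flowOK q u q→u
  ... | inj₁ (_ , u∈) = u∈
  ... | inj₂ (q∈T , _) = ⊥-elim (disjPlT q (∈-++⁺ˡ q∈) q∈T)

  P-arc-source : ∀ {q u} → q ∈ P N → Arc N u q → u ∈ T N
  P-arc-source {q} {u} q∈ u→q with flowOK u q u→q
  ... | inj₁ (_ , q∈T) = ⊥-elim (disjPlT q (∈-++⁺ˡ q∈) q∈T)
  ... | inj₂ (u∈ , _) = u∈

  input-kind : ∀ {u q} → u ∈ T N → Arc N q u → q ∈ P N ⊎ q ∈ I N
  input-kind {u} {q} u∈ q→u with flowOK q u q→u
  ... | inj₂ (_ , u∈Pl) = ⊥-elim (disjPlT u u∈Pl u∈)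
  ... | inj₁ (q∈Pl , _) with places-cases N q∈Pl
  ...   | inj₁ q∈P        = inj₁ q∈P
  ...   | inj₂ (inj₁ q∈I) = inj₂ q∈I
  ...   | inj₂ (inj₂ q∈O) = ⊥-elim (outNoPost q u q∈O q→u)

  output-kind : ∀ {u q} → u ∈ T N → Arc N u q → q ∈ P N ⊎ q ∈ O N
  output-kind {u} {q} u∈ u→q with flowOK u q u→q
  ... | inj₁ (u∈Pl , _) = ⊥-elim (disjPlT u u∈Pl u∈)
  ... | inj₂ (_ , q∈Pl) with places-cases N q∈Pl
  ...   | inj₁ q∈P        = inj₁ q∈P
  ...   | inj₂ (inj₁ q∈I) = ⊥-elim (inNoPre q u q∈I u→q)
  ...   | inj₂ (inj₂ q∈O) = inj₂ q∈O

  receive-output-place : ∀ {u q} → u ∈ T N → dir N u ≡ receive → Arc N u q → q ∈ P N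
  receive-output-place u∈ d u→q with output-kind u∈ u→q
  ... | inj₁ q∈P = q∈P
  ... | inj₂ q∈O = ⊥-elim (proj₁ (receive-view d) (lose q∈O u→q))

  input-place : ∀ {u} → u ∈ T N → ∃[ a ] (a ∈ P N × Arc N a u)
  input-place {u} u∈ with reverse (λ arc → arc) (proj₁ (onPath u (∈-++⁺ʳ (P N) u∈)))
  ... | ε = ⊥-elim (disjPlT u (∈-++⁺ˡ i∈P) u∈)
  ... | (a→u , inj₁ (a∈ , _)) ◅ _ = _ , a∈ , a→u
  ... | (_ , inj₂ (_ , u∈P)) ◅ _ = ⊥-elim (disjPlT u (∈-++⁺ˡ u∈P) u∈)

  output-place : ∀ {u} → u ∈ T N → ∃[ b ] (b ∈ P N × Arc N u b)
  output-place {u} u∈ with proj₂ (onPath u (∈-++⁺ʳ (P N) u∈))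
  ... | ε = ⊥-elim (disjPlT u (∈-++⁺ˡ f∈P) u∈)
  ... | (_ , inj₁ (u∈P , _)) ◅ _ = ⊥-elim (disjPlT u (∈-++⁺ˡ u∈P) u∈)
  ... | (u→b , inj₂ (_ , b∈)) ◅ _ = _ , b∈ , u→b

  interface-unique : ∀ {u y z} → u ∈ T N → y ∈ Ifc N → Conn N y u → z ∈ Ifc N → Conn N z u → y ≡ z
  interface-unique {u} {y} {z} u∈ y∈ y-u z∈ z-u with oneIfc u u∈
  ... | _ , _ , _ , unique = trans (unique y y∈ y-u) (sym (unique z z∈ z-u))

  P≢I : ∀ {a x} → a ∈ P N → x ∈ I N → a ≢ x
  P≢I a∈ x∈ refl = disjPI _ a∈ x∈

  P≢O : ∀ {b o} → b ∈ P N → o ∈ O N → b ≢ o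
  P≢O b∈ o∈ refl = disjPO _ b∈ o∈

  pre-on-places : ∀ {u a q} → u ∈ T N → a ∈ P N → Arc N a u → q ∈ P N → pre N u q ≡ δ a q
  pre-on-places {u} {a} {q} u∈ a∈ a→u q∈ =
    ind-⇔ (mk⇔ (λ q→u → oneIn u q a u∈ q∈ a∈ q→u a→u) λ { refl → a→u }) (PairMem._∈?_ (q , u) (F N)) (q ≟ a)

  post-on-places : ∀ {u b q} → u ∈ T N → b ∈ P N → Arc N u b → q ∈ P N → post N u q ≡ δ b q
  post-on-places {u} {b} {q} u∈ b∈ u→b q∈ =
    ind-⇔ (mk⇔ (λ u→q → oneOut u q b u∈ q∈ b∈ u→q u→b) λ { refl → u→b }) (PairMem._∈?_ (u , q) (F N)) (q ≟ b)

  pre-send : ∀ {u a} → u ∈ T N → dir N u ≡ send → a ∈ P N → Arc N a u → pre N u ≗ δ a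
  pre-send {u} {a} u∈ d a∈ a→u = indicator-δ (λ q → PairMem._∈?_ (q , u) (F N)) λ q → mk⇔
    (λ q→u → [ (λ q∈P → oneIn u q a u∈ q∈P a∈ q→u a→u) , (λ q∈I → ⊥-elim (send-no-input u∈ d q∈I q→u)) ]
               (input-kind u∈ q→u))
    λ { refl → a→u }

  post-send : ∀ {u b o} → u ∈ T N → b ∈ P N → Arc N u b → o ∈ O N → Arc N u o → post N u ≗ δ b ⊕ δ o
  post-send {u} {b} {o} u∈ b∈ u→b o∈ u→o =
    indicator-δ⊕δ (λ q → PairMem._∈?_ (u , q) (F N)) (P≢O b∈ o∈) λ q → mk⇔
      (λ u→q → map (λ q∈P → oneOut u q b u∈ q∈P b∈ u→q u→b)
                   (λ q∈O → interface-unique u∈ (∈-++⁺ʳ (I N) q∈O) (inj₂ u→q) (∈-++⁺ʳ (I N) o∈) (inj₂ u→o))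
                   (output-kind u∈ u→q))
      [ (λ { refl → u→b }) , (λ { refl → u→o }) ]

  pre-receive : ∀ {u a x} → u ∈ T N → a ∈ P N → Arc N a u → x ∈ I N → Arc N x u → pre N u ≗ δ a ⊕ δ x
  pre-receive {u} {a} {x} u∈ a∈ a→u x∈ x→u =
    indicator-δ⊕δ (λ q → PairMem._∈?_ (q , u) (F N)) (P≢I a∈ x∈) λ q → mk⇔
      (λ q→u → map (λ q∈P → oneIn u q a u∈ q∈P a∈ q→u a→u)
                   (λ q∈I → interface-unique u∈ (∈-++⁺ˡ q∈I) (inj₁ q→u) (∈-++⁺ˡ x∈) (inj₁ x→u))
                   (input-kind u∈ q→u))
      [ (λ { refl → a→u }) , (λ { refl → x→u }) ]

  post-receive : ∀ {u b} → u ∈ T N → dir N u ≡ receive → b ∈ P N → Arc N u b → post N u ≗ δ b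
  post-receive {u} {b} u∈ d b∈ u→b = indicator-δ (λ q → PairMem._∈?_ (u , q) (F N)) λ q → mk⇔
    (λ u→q → [ (λ q∈P → oneOut u q b u∈ q∈P b∈ u→q u→b) , (λ q∈O → ⊥-elim (proj₁ (receive-view d) (lose q∈O u→q))) ]
               (output-kind u∈ u→q))
    λ { refl → u→b }

module Composition (N M : OPN) (well-formed : WellFormed N) (isOPN-M : IsOPN M) (composable : Composable N M) where
  open WellFormed well-formed using (portnet; diamond)
  open IsLPortnet portnet using (isOPN; init≡) renaming (i to i-N)
  open IsOPN isOPN using (disjPI; disjPO; disjPlT)
  open LabeledPortnet portnet

  S : OPN
  S = compose N M

  internal-not-in-M : ∀ {x} → x ∈ Nodes N → x ∉ Ifc N → x ∉ Nodes M
  internal-not-in-M x∈N x∉Ifc x∈M = x∉Ifc (proj₁ (proj₁ composable _ x∈N x∈M))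

  place-not-in-M : ∀ {q} → q ∈ P N → q ∉ Nodes M
  place-not-in-M q∈ = internal-not-in-M (places⊆nodes N (∈-++⁺ˡ q∈))
    λ q∈Ifc → [ disjPI _ q∈ , disjPO _ q∈ ] (∈-++⁻ (I N) q∈Ifc)

  transition-not-in-M : ∀ {u} → u ∈ T N → u ∉ Nodes M
  transition-not-in-M u∈ = internal-not-in-M (transitions⊆nodes N u∈)
    λ u∈Ifc → disjPlT _ (∈-++⁺ʳ (P N) u∈Ifc) u∈

  N-arc : ∀ {x y} → x ∉ Nodes M ⊎ y ∉ Nodes M → Arc S x y → Arc N x y
  N-arc avoids-M x→y with ∈-++⁻ (F N) x→y
  ... | inj₁ x→y-in-N = x→y-in-N
  ... | inj₂ x→y-in-M = ⊥-elim ([ (λ x∉ → x∉ (proj₁ (arc-nodes isOPN-M x→y-in-M)))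
                               , (λ y∉ → y∉ (proj₂ (arc-nodes isOPN-M x→y-in-M))) ] avoids-M)

  pre-compose : ∀ {u} → u ∈ T N → pre S u ≗ pre N u
  pre-compose {u} u∈ q = ind-⇔ (mk⇔ (N-arc (inj₂ (transition-not-in-M u∈))) ∈-++⁺ˡ)
    (PairMem._∈?_ (q , u) (F S)) (PairMem._∈?_ (q , u) (F N))

  post-compose : ∀ {u} → u ∈ T N → post S u ≗ post N u
  post-compose {u} u∈ q = ind-⇔ (mk⇔ (N-arc (inj₁ (transition-not-in-M u∈))) ∈-++⁺ˡ)
    (PairMem._∈?_ (u , q) (F S)) (PairMem._∈?_ (u , q) (F N))

  M-transition-avoids-P : ∀ {u q} → u ∈ T M → q ∈ P N → pre S u q ≡ 0 × post S u q ≡ 0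
  M-transition-avoids-P {u} {q} u∈M q∈ =
    ind-absent (PairMem._∈?_ (q , u) (F S)) (λ q→u → not-in-N (P-arc-target q∈ (N-arc (inj₁ q∉M) q→u))) ,
    ind-absent (PairMem._∈?_ (u , q) (F S)) (λ u→q → not-in-N (P-arc-source q∈ (N-arc (inj₂ q∉M) u→q)))
    where
    q∉M : q ∉ Nodes M
    q∉M = place-not-in-M q∈
    not-in-N : u ∉ T N
    not-in-N u∈N = transition-not-in-M u∈N (transitions⊆nodes M u∈M)

  TokenAt : Node → Marking → Set
  TokenAt p m = ∀ q → q ∈ P N → m q ≡ δ p q

  token-init : TokenAt i-N (initS N M)
  token-init q q∈ = begin
    mark (init N) q + mark (init M) q
      ≡⟨ cong₂ _+_ (ind-⇔ (mk⇔ (proj₁ init≡ q) λ { refl → proj₂ init≡ }) (NatMem._∈?_ q (init N)) (q ≟ i-N))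
                   (ind-absent (NatMem._∈?_ q (init M)) not-initial-in-M) ⟩
    δ i-N q + 0
      ≡⟨ +-identityʳ (δ i-N q) ⟩
    δ i-N q ∎
    where
    open ≡-Reasoning
    not-initial-in-M : q ∉ init M
    not-initial-in-M q∈init = place-not-in-M q∈ (places⊆nodes M (∈-++⁺ˡ (IsOPN.initOK isOPN-M q q∈init)))

  token-unique : ∀ {p m a} → TokenAt p m → a ∈ P N → 1 ≤ m a → a ≡ p
  token-unique {p} {m} {a} token a∈ a-marked = ind-positive (a ≟ p) (subst (1 ≤_) (token a a∈) a-marked)

  input-marked : ∀ {m u m′ a} → Fire S m u m′ → Arc N a u → 1 ≤ m a
  input-marked {m} {u} {m′} {a} (_ , enabled , _) a→u =
    subst (_≤ m a) (ind-present (PairMem._∈?_ (a , u) (F S)) (∈-++⁺ˡ a→u)) (enabled a)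

  token-step : ∀ {p m m′} → TokenAt p m → Step S m m′ → ∃[ p′ ] TokenAt p′ m′
  token-step {p} {m} {m′} token (u , u-fires@(u∈S , _ , balance)) with ∈-++⁻ (T N) u∈S
  ... | inj₂ u∈M = p , λ q q∈ → trans (unchanged q∈) (token q q∈)
    where
    unchanged : ∀ {q} → q ∈ P N → m′ q ≡ m q
    unchanged {q} q∈ with M-transition-avoids-P u∈M q∈
    ... | pre≡0 , post≡0 = +-cancelʳ-≡ 0 (m′ q) (m q) (subst₂ (λ k l → m′ q + k ≡ m q + l) pre≡0 post≡0 (balance q))
  ... | inj₁ u∈N with input-place u∈N | output-place u∈N
  ...   | a , a∈ , a→u | b , b∈ , u→b = b , moved
    where
    a≡p : a ≡ p
    a≡p = token-unique token a∈ (input-marked u-fires a→u)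
    moved : TokenAt b m′
    moved q q∈ = +-cancelʳ-≡ (δ a q) (m′ q) (δ b q) (begin
      m′ q + δ a q      ≡⟨ cong (m′ q +_) (trans (pre-compose u∈N q) (pre-on-places u∈N a∈ a→u q∈)) ⟨
      m′ q + pre S u q  ≡⟨ balance q ⟩
      m q + post S u q  ≡⟨ cong₂ _+_ (trans (token q q∈) (cong (λ z → δ z q) (sym a≡p)))
                                     (trans (post-compose u∈N q) (post-on-places u∈N b∈ u→b q∈)) ⟩
      δ a q + δ b q     ≡⟨ +-comm (δ a q) (δ b q) ⟩
      δ b q + δ a q     ∎)
      where open ≡-Reasoning

  reachable-token : ∀ {m} → Reach S (initS N M) m → ∃[ p ] TokenAt p m
  reachable-token = preserve (i-N , token-init)
    where
    preserve : ∀ {m m′} → ∃[ p ] TokenAt p m → Star (Step S) m m′ → ∃[ p ] TokenAt p m′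
    preserve token ε = token
    preserve (_ , token) (step ◅ steps) = preserve (token-step token step) steps

  reachable-marked-unique : ∀ {m a b} → Reach S (initS N M) m → a ∈ P N → b ∈ P N → 1 ≤ m a → 1 ≤ m b → a ≡ b
  reachable-marked-unique reach a∈ b∈ a-marked b-marked with reachable-token reach
  ... | _ , token = trans (token-unique token a∈ a-marked) (sym (token-unique token b∈ b-marked))

  PrePost : Node → Marking → Marking → Set
  PrePost u consumed produced = pre S u ≗ consumed × post S u ≗ produced

  send-prepost : ∀ {u a b o} → u ∈ T N → dir N u ≡ send → a ∈ P N → Arc N a u → b ∈ P N → Arc N u b →
                 o ∈ O N → Arc N u o → PrePost u (δ a) (δ b ⊕ δ o)
  send-prepost u∈ d a∈ a→u b∈ u→b o∈ u→o =
    (λ q → trans (pre-compose u∈ q) (pre-send u∈ d a∈ a→u q)) ,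
    (λ q → trans (post-compose u∈ q) (post-send u∈ b∈ u→b o∈ u→o q))

  receive-prepost : ∀ {u a x b} → u ∈ T N → dir N u ≡ receive → a ∈ P N → Arc N a u → x ∈ I N → Arc N x u →
                    b ∈ P N → Arc N u b → PrePost u (δ a ⊕ δ x) (δ b)
  receive-prepost u∈ d a∈ a→u x∈ x→u b∈ u→b =
    (λ q → trans (pre-compose u∈ q) (pre-receive u∈ a∈ a→u x∈ x→u q)) ,
    (λ q → trans (post-compose u∈ q) (post-receive u∈ d b∈ u→b q))

  record Diamond (p s t : Node) : Set where
    field
      r o x b r′ u u′ : Node
      u∈T        : u ∈ T N
      u′∈T       : u′ ∈ T N
      t≈u        : SameAction N t u
      s≈u′       : SameAction N s u′
      s-prepost  : PrePost s (δ p) (δ r ⊕ δ o)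
      t-prepost  : PrePost t (δ p ⊕ δ x) (δ b)
      u-prepost  : PrePost u (δ r ⊕ δ x) (δ r′)
      u′-prepost : PrePost u′ (δ b) (δ r′ ⊕ δ o)

  diamond-completion : ∀ {p s t} → p ∈ P N → Arc N p s → Arc N p t →
    s ∈ T N → dir N s ≡ send → t ∈ T N → dir N t ≡ receive → Diamond p s t
  diamond-completion {p} {s} {t} p∈ p→s p→t s∈ ds t∈ dt
    with output-place s∈ | find (sends-of-send ds) | output-place t∈ | find (proj₂ (receive-view dt))
  ... | r , r∈ , s→r | o , o∈ , s→o | b , b∈ , t→b | x , x∈ , x→t
    with diamond p s t p∈ p→s p→t (λ ds≡dt → send≢receive (trans (sym ds) (trans ds≡dt dt))) r b s→r r∈ t→b b∈
  ... | u , u′ , r→u , b→u′ , (r′ , u→r′ , u′→r′) , μs≡μu′ , μt≡μu = record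
    { r = r ; o = o ; x = x ; b = b ; r′ = r′ ; u = u ; u′ = u′
    ; u∈T = u∈ ; u′∈T = u′∈
    ; t≈u = μt≡μu , dir-μ t∈ u∈ μt≡μu
    ; s≈u′ = μs≡μu′ , dir-μ s∈ u′∈ μs≡μu′
    ; s-prepost = send-prepost s∈ ds p∈ p→s r∈ s→r o∈ s→o
    ; t-prepost = receive-prepost t∈ dt p∈ p→t x∈ x→t b∈ t→b
    ; u-prepost = receive-prepost u∈ du r∈ r→u x∈ (input-transfer t∈ u∈ μt≡μu x∈ x→t) r′∈ u→r′
    ; u′-prepost = send-prepost u′∈ du′ b∈ b→u′ r′∈ u′→r′ o∈ (output-transfer s∈ u′∈ μs≡μu′ o∈ s→o)
    }
    where
    u∈ : u ∈ T N
    u∈ = P-arc-target r∈ r→u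
    u′∈ : u′ ∈ T N
    u′∈ = P-arc-target b∈ b→u′
    du : dir N u ≡ receive
    du = trans (sym (dir-μ t∈ u∈ μt≡μu)) dt
    du′ : dir N u′ ≡ send
    du′ = trans (sym (dir-μ s∈ u′∈ μs≡μu′)) ds
    r′∈ : r′ ∈ P N
    r′∈ = receive-output-place u∈ du u→r′

  record Square (m₀ m₁ : Marking) (s t : Node) : Set where
    field
      u u′    : Node
      m₂      : Marking
      u∈T     : u ∈ T N
      u′∈T    : u′ ∈ T N
      t≈u     : SameAction N t u
      s≈u′    : SameAction N s u′
      fire-u  : Fire S m₀ u m₂
      fire-u′ : Fire S m₁ u′ m₂

  commuting-square : ∀ {m m₀ m₁ s t} → Reach S (initS N M) m →
    s ∈ T N → dir N s ≡ send → Fire S m s m₀ →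
    t ∈ T N → dir N t ≡ receive → Fire S m t m₁ → Square m₀ m₁ s t
  commuting-square {m} {m₀} {m₁} {s} {t} reach s∈ ds fire-s t∈ dt fire-t
    with input-place s∈ | input-place t∈
  ... | p , p∈ , p→s | a , a∈ , a→t = record
    { u = u ; u′ = u′ ; m₂ = m₂ ; u∈T = u∈T ; u′∈T = u′∈T ; t≈u = t≈u ; s≈u′ = s≈u′
    ; fire-u = fire-square S fire-s fire-t fire-u′ (∈-++⁺ˡ u∈T) (enabled-after S fire-s t-enabled u-bound) same-effect
    ; fire-u′ = fire-u′
    }
    where
    p→t : Arc N p t
    p→t = subst (λ z → Arc N z t)
                (reachable-marked-unique reach a∈ p∈ (input-marked fire-t a→t) (input-marked fire-s p→s)) a→t
    open Diamond (diamond-completion p∈ p→s p→t s∈ ds t∈ dt)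

    t-enabled : ∀ q → pre S t q ≤ m q
    t-enabled = proj₁ (proj₂ fire-t)

    u′-bound : ∀ q → pre S u′ q + pre S t q ≤ pre S t q + post S t q
    u′-bound q = ≤-reflexive (trans (cong (_+ pre S t q) (trans (proj₁ u′-prepost q) (sym (proj₂ t-prepost q))))
                                    (+-comm (post S t q) (pre S t q)))

    m₂ : Marking
    m₂ q = m₁ q + post S u′ q ∸ pre S u′ q

    fire-u′ : Fire S m₁ u′ m₂
    fire-u′ = fire S (∈-++⁺ˡ u′∈T) (enabled-after S fire-t t-enabled u′-bound)

    u-bound : ∀ q → pre S u q + pre S s q ≤ pre S t q + post S s q
    u-bound q = begin
      pre S u q + pre S s q          ≡⟨ cong₂ _+_ (proj₁ u-prepost q) (proj₁ s-prepost q) ⟩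
      δ r q + δ x q + δ p q          ≡⟨ swap-ends (δ r q) (δ x q) (δ p q) ⟩
      δ p q + δ x q + δ r q          ≤⟨ +-monoʳ-≤ (δ p q + δ x q) (m≤m+n (δ r q) (δ o q)) ⟩
      δ p q + δ x q + (δ r q + δ o q) ≡⟨ cong₂ _+_ (proj₁ t-prepost q) (proj₂ s-prepost q) ⟨
      pre S t q + post S s q         ∎
      where
      open ≤-Reasoning
      swap-ends : ∀ r x p → r + x + p ≡ p + x + r
      swap-ends = solve-∀

    same-effect : ∀ q → pre S s q + pre S u q + post S t q + post S u′ q ≡ pre S t q + pre S u′ q + post S s q + post S u q
    same-effect q = begin
      pre S s q + pre S u q + post S t q + post S u′ q
        ≡⟨ cong₂ _+_ (cong₂ _+_ (cong₂ _+_ (proj₁ s-prepost q) (proj₁ u-prepost q)) (proj₂ t-prepost q)) (proj₂ u′-prepost q) ⟩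
      δ p q + (δ r q + δ x q) + δ b q + (δ r′ q + δ o q)
        ≡⟨ reorder (δ p q) (δ r q) (δ x q) (δ b q) (δ r′ q) (δ o q) ⟩
      δ p q + δ x q + δ b q + (δ r q + δ o q) + δ r′ q
        ≡⟨ cong₂ _+_ (cong₂ _+_ (cong₂ _+_ (proj₁ t-prepost q) (proj₁ u′-prepost q)) (proj₂ s-prepost q)) (proj₂ u-prepost q) ⟨
      pre S t q + pre S u′ q + post S s q + post S u q ∎
      where
      open ≡-Reasoning
      reorder : ∀ p r x b r′ o → p + (r + x) + b + (r′ + o) ≡ p + x + b + (r + o) + r′
      reorder = solve-∀

  record Ladder (n : ℕ) (ms : Fin (suc n) → Marking) (ts : Fin n → Node) (s : Node) (m₀ : Marking) : Set where
    field
      ms′        : Fin (suc n) → Marking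
      ts′        : Fin n → Node
      rungs      : Fin (suc n) → Node
      ms′-start  : ms′ zero ≡ m₀
      ts′∈T      : ∀ j → ts′ j ∈ T N
      ts′-fire   : ∀ j → Fire S (ms′ (inject₁ j)) (ts′ j) (ms′ (suc j))
      ts≈ts′     : ∀ j → SameAction N (ts j) (ts′ j)
      rungs∈T    : ∀ j → rungs j ∈ T N
      rungs-fire : ∀ j → Fire S (ms j) (rungs j) (ms′ j)
      s≈rungs    : ∀ j → SameAction N s (rungs j)

  ladder : ∀ n (ms : Fin (suc n) → Marking) (ts : Fin n → Node) {s m₀} →
    (∀ j → Reach S (initS N M) (ms j)) → (∀ j → ts j ∈ T N) →
    (∀ j → Fire S (ms (inject₁ j)) (ts j) (ms (suc j))) → (∀ j → dir N (ts j) ≡ receive) →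
    s ∈ T N → dir N s ≡ send → Fire S (ms zero) s m₀ → Ladder n ms ts s m₀
  ladder zero ms ts {s} {m₀} _ _ _ _ s∈ _ fire-s = record
    { ms′ = λ _ → m₀ ; ts′ = λ () ; rungs = λ _ → s ; ms′-start = refl
    ; ts′∈T = λ () ; ts′-fire = λ () ; ts≈ts′ = λ ()
    ; rungs∈T = λ _ → s∈ ; rungs-fire = λ { zero → fire-s } ; s≈rungs = λ _ → refl , refl
    }
  ladder (suc n) ms ts {s} {m₀} reach ts∈ ts-fire ts-dir s∈ ds fire-s = record
    { ms′        = λ { zero → m₀ ; (suc j) → Rest.ms′ j }
    ; ts′        = λ { zero → u ; (suc j) → Rest.ts′ j }
    ; rungs      = λ { zero → s ; (suc j) → Rest.rungs j }
    ; ms′-start  = refl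
    ; ts′∈T      = λ { zero → u∈T ; (suc j) → Rest.ts′∈T j }
    ; ts′-fire   = λ { zero → subst (Fire S m₀ u) (sym Rest.ms′-start) fire-u ; (suc j) → Rest.ts′-fire j }
    ; ts≈ts′     = λ { zero → t≈u ; (suc j) → Rest.ts≈ts′ j }
    ; rungs∈T    = λ { zero → s∈ ; (suc j) → Rest.rungs∈T j }
    ; rungs-fire = λ { zero → fire-s ; (suc j) → Rest.rungs-fire j }
    ; s≈rungs    = λ { zero → refl , refl ; (suc j) → same-action-trans {N} s≈u′ (Rest.s≈rungs j) }
    }
    where
    open Square (commuting-square (reach zero) s∈ ds fire-s (ts∈ zero) (ts-dir zero) (ts-fire zero))
    module Rest = Ladder (ladder n (λ j → ms (suc j)) (λ j → ts (suc j)) (λ j → reach (suc j)) (λ j → ts∈ (suc j))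
                                 (λ j → ts-fire (suc j)) (λ j → ts-dir (suc j))
                                 u′∈T (trans (sym (proj₂ s≈u′)) ds) fire-u′)

lemma2 : (N M : OPN) (φ : Node → Node) →
    WellFormed N → WellFormed M → PartialMirror N M φ → Composable N M →
    (n : ℕ) (ms : Fin (suc n) → Marking) (ts : Fin n → Node)
    (t : Node) (m' : Marking) →
    (∀ j → Reach (compose N M) (initS N M) (ms j)) →
    Reach (compose N M) (initS N M) m' →
    (∀ j → ts j ∈ T N) → t ∈ T N →
    (∀ j → Fire (compose N M) (ms (inject₁ j)) (ts j) (ms (suc j))) →
    (∀ j → dir N (ts j) ≡ receive) →
    Fire (compose N M) (ms zero) t m' → dir N t ≡ send →
    Σ (Fin (suc n) → Marking) λ ms' → Σ (Fin n → Node) λ ts' → ∃[ tb ]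
      ((∀ j → Reach (compose N M) (initS N M) (ms' j)) ×
       (∀ j → ts' j ∈ T N) × tb ∈ T N ×
       ms' zero ≗ m' ×
       (∀ j → Fire (compose N M) (ms' (inject₁ j)) (ts' j) (ms' (suc j))) ×
       Fire (compose N M) (ms (fromℕ n)) tb (ms' (fromℕ n)) ×
       (∀ j → μ N (ts j) ≡ μ N (ts' j) × dir N (ts j) ≡ dir N (ts' j)) ×
       μ N t ≡ μ N tb × dir N t ≡ dir N tb)
lemma2 N M _ well-formed-N well-formed-M _ composable n ms ts t _ reach _ ts∈ t∈ ts-fire ts-dir fire-t dt =
  ms′ , ts′ , rungs (fromℕ n) ,
  (λ j → reach j ◅◅ ((rungs j , rungs-fire j) ◅ ε)) ,
  ts′∈T , rungs∈T (fromℕ n) , cong-app ms′-start , ts′-fire , rungs-fire (fromℕ n) ,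
  ts≈ts′ , s≈rungs (fromℕ n)
  where
  open Composition N M well-formed-N (IsLPortnet.isOPN (WellFormed.portnet well-formed-M)) composable
  open Ladder (ladder n ms ts reach ts∈ ts-fire ts-dir t∈ dt fire-t)
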